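{- Let $a_1,\ldots,a_m$ be integers summing to $0$ and let $b_1,\ldots,b_m$ be non-negative integers such that $b_i>0$ whenever $a_i\ge0$. Consider applying the connected-correlator algorithm (described in the context) to $\langle\mathcal{E}_{a_1}(b_1\hbar)\cdots\mathcal{E}_{a_m}(b_m\hbar)\rangle^\circ$. In each application of Step (4) to a term with score $s$, the resulting commutation term also has score $s$, while the resulting passing term has score $s-2t$ for some positive integer $t$. In particular, at any stage of the algorithm, every term produced has score at most the score of the original connected correlator and of the same parity.
   Context: The $q$-integers are $[k]=e^{k\hbar/2}-e^{ -k\hbar/2}$. The operators $\mathcal{E}_a(b\hbar)$ ($a\in\mathbb{Z}$) act on the infinite wedge space $\Lambda$ (the complex vector space with orthonormal basis $v_\lambda$ indexed by partitions), defined as follows: with content of box $(i,j)$ equal to $j-i$, an $m$-ribbon being a connected set of $m$ boxes with no $2\times 2$ subsquare whose removal leaves a Young diagram, with sign $(-1)^{\#\text{rows}-1}$ and centre $c$ the average content of its boxes, $\mathcal{E}_m(z)v_\lambda$ for $m<0$ (resp. $m>0$) is the sum of $\mathrm{sign}\cdot e^{cz}v_\mu$ over all $\mu$ obtained by adding an $|m|$-ribbon to (resp. removing an $m$-ribbon from) $\lambda$, and $\mathcal{E}_0(z)$ is diagonal with eigenvalue $\sum_{i=1}^d(e^{(\alpha_i+1/2)z}-e^{ -(\beta_i+1/2)z})+\frac{1}{e^{z/2}-e^{ -z/2}}$ on $v_\lambda$, $\lambda=(\alpha_1,\ldots,\alpha_d\mid\beta_1,\ldots,\beta_d)$ in Frobenius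 notation. Correlators are $\langle\mathcal{F}\rangle=\langle v_\emptyset,\mathcal{F}v_\emptyset\rangle$. Connected-correlator algorithm: for integers $a_i$ and non-negative integers $b_i$ with $b_i>0$ whenever $a_i\ge 0$, $\langle\mathcal{E}_{a_1}(b_1\hbar)\cdots\mathcal{E}_{a_m}(b_m\hbar)\rangle^\circ$ is computed by: (1) if $\sum a_i\ne0$ return $0$; (2) if $a_1+\cdots+a_i\le0$ for some $1\le i<m$ return $0$; (3) if all $a_i=0$ return $\delta_{m,1}/[b_1]$; (4) otherwise, letting $\mathcal{E}_{a_i}(b_i\hbar)$ be the rightmost operator with positive subscript, return the passing term $\langle\mathcal{E}_{a_1}(b_1\hbar)\cdots\mathcal{E}_{a_{i+1}}(b_{i+1}\hbar)\mathcal{E}_{a_i}(b_i\hbar)\cdots\mathcal{E}_{a_m}(b_m\hbar)\rangle^\circ$ plus the commutation term $[a_ib_{i+1}-a_{i+1}b_i]\,\langle\mathcal{E}_{a_1}(b_1\hbar)\cdots\mathcal{E}_{a_i+a_{i+1}}((b_i+b_{i+1})\hbar)\cdots\mathcal{E}_{a_m}(b_m\hbar)\rangle^\circ$. During the algorithm one handles expressions $[k_1]\cdots[k_\ell]\langle\mathcal{E}_{a_1}(b_1\hbar)\cdots\mathcal{E}_{a_m}(b_m\hbar)\rangle$ (the prefactors accumulating the $q$-integer factors of commutation terms). Score: the score of such an expression is the integer $(k_1+\cdots+k_\ell)-(b_1+\cdots+b_m)+\sum_{1\le i<j\le m}(a_ib_j-a_jb_i)$. -}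

module Defs where

open import Data.Nat using (ℕ) renaming (_+_ to _+ℕ_; _<_ to _<ℕ_)
open import Data.Integer using (ℤ; +_; _+_; _-_; _*_; _≤_; _<_; 0ℤ)
open import Data.List using (List; []; _∷_; _++_; [_])
open import Data.List.Relation.Unary.All using (All)
open import Data.Product using (_×_; _,_; proj₁; proj₂)
open import Relation.Binary.PropositionalEquality using (_≡_; _≢_)
open import Relation.Nullary using (¬_)
open import Relation.Binary.Construct.Closure.ReflexiveTransitive using (Star)

-- An operator E_a(b ħ) is recorded as the pair (a , b) with a : ℤ, b : ℕ (b ≥ 0).
Op : Set
Op = ℤ × ℕ

Good : Op → Set
Good (a , b) = 0ℤ ≤ a → 0 <ℕ b

-- An expression [k_1]⋯[k_ℓ] ⟨E_{a_1}(b_1ħ)⋯E_{a_m}(b_mħ)⟩°.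
record Term : Set where
  constructor term
  field
    prefactors : List ℤ
    ops        : List Op
open Term public

sumℤ : List ℤ → ℤ
sumℤ []       = 0ℤ
sumℤ (k ∷ ks) = k + sumℤ ks

sumA : List Op → ℤ
sumA []             = 0ℤ
sumA ((a , _) ∷ os) = a + sumA os

sumB : List Op → ℤ
sumB []             = 0ℤ
sumB ((_ , b) ∷ os) = + b + sumB os

det : Op → Op → ℤ
det (a , b) (a' , b') = a * + b' - a' * + b

detWith : Op → List Op → ℤ
detWith o []        = 0ℤ
detWith o (o' ∷ os) = det o o' + detWith o os

cross : List Op → ℤ
cross []       = 0ℤ
cross (o ∷ os) = detWith o os + cross os

score : Term → ℤ
score (term ks os) = sumℤ ks - sumB os + cross os

-- Steps (1),(2),(3) of the algorithm do not apply, so Step (4) is applied: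
-- Σ a_i = 0, every proper nonempty prefix has positive a-sum, and not all a_i = 0.
ReachesStep4 : List Op → Set
ReachesStep4 os =
  (sumA os ≡ 0ℤ) ×
  ((pre post : List Op) → os ≡ pre ++ post → pre ≢ [] → post ≢ [] → 0ℤ < sumA pre) ×
  ¬ All (λ o → proj₁ o ≡ 0ℤ) os

-- Step4 T P C : applying Step (4) to the term T yields the passing term P
-- and the commutation term C.  The distinguished operator (a , b) is the
-- rightmost one with positive subscript: every operator to its right has a ≤ 0.
data Step4 : Term → Term → Term → Set where
  step4 : ∀ (ks : List ℤ) (pre post : List Op) (a a' : ℤ) (b b' : ℕ) →
          ReachesStep4 (pre ++ (a , b) ∷ (a' , b') ∷ post) →
          0ℤ < a →
          All (λ o → proj₁ o ≤ 0ℤ) ((a' , b') ∷ post) →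
          Step4 (term ks (pre ++ (a , b) ∷ (a' , b') ∷ post))
                (term ks (pre ++ (a' , b') ∷ (a , b) ∷ post))
                (term (ks ++ [ det (a , b) (a' , b') ])
                      (pre ++ (a + a' , b +ℕ b') ∷ post))

data Step : Term → Term → Set where
  passing     : ∀ {T P C} → Step4 T P C → Step T P
  commutation : ∀ {T P C} → Step4 T P C → Step T C

Produced : Term → Term → Set
Produced T₀ T = Star Step T₀ T

{-# OPTIONS --safe #-}
module Submission where

-- The score depends on the operators only through Σ b_i and the cross sum
-- Σ_{i<j} det(o_i, o_j), and cross (xs ++ ys) = cross xs + cross ys + det(Σ xs, Σ ys).
-- Hence replacing a block by one with the same totals changes the score by exactly
-- the change in the block's own cross sum.  Swapping an adjacent pair o o′ lowers
-- it by 2 det(o, o′); merging the pair lowers it by det(o, o′), which the new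
-- prefactor [det(o, o′)] gives back.  At Step (4), o = (a, b) has a > 0 and
-- o′ = (a′, b′) has a′ ≤ 0, so admissibility (preserved by both moves) makes
-- det(o, o′) = a b′ − a′ b positive.

open import Defs
open import Data.Nat using (suc; z≤n; s≤s) renaming (_+_ to _+ℕ_)
import Data.Nat.Properties as ℕ
import Data.Nat.Divisibility as ℕD
open import Data.Integer
  using (ℤ; +_; _+_; _-_; _*_; _≤_; _<_; 0ℤ; +0; +[1+_]; -[1+_]; +≤+; +<+; nonNegative)
import Data.Integer.Properties as ℤ
open import Data.Integer.Divisibility using (_∣_)
import Data.Integer.Divisibility.Signed as Signed
open import Data.Integer.Tactic.RingSolver using (solve-∀)
open import Data.List using (List; []; _∷_; _++_; [_])
open import Data.List.Relation.Unary.All using (All; []; _∷_)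
open import Data.List.Relation.Unary.All.Properties using (++⁺; ++⁻)
open import Data.Product using (_×_; Σ; _,_; proj₁)
open import Relation.Binary.PropositionalEquality using (_≡_; refl; sym; trans; cong; subst; module ≡-Reasoning)
open import Relation.Binary.Construct.Closure.ReflexiveTransitive using (ε; _◅_)

open ≡-Reasoning

sumℤ-∷ʳ : ∀ ks k → sumℤ (ks ++ [ k ]) ≡ sumℤ ks + k
sumℤ-∷ʳ []        k = trans (ℤ.+-identityʳ k) (sym (ℤ.+-identityˡ k))
sumℤ-∷ʳ (k′ ∷ ks) k = trans (cong (_+_ k′) (sumℤ-∷ʳ ks k)) (sym (ℤ.+-assoc k′ (sumℤ ks) k))

sumA-++ : ∀ xs ys → sumA (xs ++ ys) ≡ sumA xs + sumA ys
sumA-++ []             ys = sym (ℤ.+-identityˡ (sumA ys))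
sumA-++ ((a , _) ∷ xs) ys = trans (cong (_+_ a) (sumA-++ xs ys)) (sym (ℤ.+-assoc a (sumA xs) (sumA ys)))

sumB-++ : ∀ xs ys → sumB (xs ++ ys) ≡ sumB xs + sumB ys
sumB-++ []             ys = sym (ℤ.+-identityˡ (sumB ys))
sumB-++ ((_ , b) ∷ xs) ys = trans (cong (_+_ (+ b)) (sumB-++ xs ys)) (sym (ℤ.+-assoc (+ b) (sumB xs) (sumB ys)))

detWith-linear : ∀ a b os → detWith (a , b) os ≡ a * sumB os - sumA os * + b
detWith-linear a b [] rewrite ℤ.*-zeroʳ a = refl
detWith-linear a b ((a′ , b′) ∷ os) = begin
  det (a , b) (a′ , b′) + detWith (a , b) os
    ≡⟨ cong (_+_ (det (a , b) (a′ , b′))) (detWith-linear a b os) ⟩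
  (a * + b′ - a′ * + b) + (a * sumB os - sumA os * + b)
    ≡⟨ ring a (+ b) a′ (+ b′) (sumA os) (sumB os) ⟩
  a * (+ b′ + sumB os) - (a′ + sumA os) * + b ∎
  where
  ring : ∀ a b a′ b′ A B → (a * b′ - a′ * b) + (a * B - A * b) ≡ a * (b′ + B) - (a′ + A) * b
  ring = solve-∀

cross-++ : ∀ xs ys →
  cross (xs ++ ys) ≡ cross xs + cross ys + (sumA xs * sumB ys - sumA ys * sumB xs)
cross-++ [] ys = ring (cross ys) (sumA ys) (sumB ys)
  where
  ring : ∀ c A B → c ≡ 0ℤ + c + (0ℤ * B - A * 0ℤ)
  ring = solve-∀
cross-++ ((a , b) ∷ xs) ys
  rewrite detWith-linear a b (xs ++ ys) | detWith-linear a b xs | cross-++ xs ys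
        | sumA-++ xs ys | sumB-++ xs ys
  = ring a (+ b) (sumA xs) (sumB xs) (sumA ys) (sumB ys) (cross xs) (cross ys)
  where
  ring : ∀ a b Ax Bx Ay By cx cy →
    (a * (Bx + By) - (Ax + Ay) * b) + (cx + cy + (Ax * By - Ay * Bx))
      ≡ (a * Bx - Ax * b) + cx + cy + ((a + Ax) * By - Ay * (b + Bx))
  ring = solve-∀

record CrossDrop (d : ℤ) (M M′ : List Op) : Set where
  field
    sumA-≡  : sumA M′ ≡ sumA M
    sumB-≡  : sumB M′ ≡ sumB M
    cross-≡ : cross M′ ≡ cross M - d
open CrossDrop

CrossDrop-++ʳ : ∀ {d M M′} ys → CrossDrop d M M′ → CrossDrop d (M ++ ys) (M′ ++ ys)
CrossDrop-++ʳ {d} {M} {M′} ys δ = record { sumA-≡ = sumA-≡′ ; sumB-≡ = sumB-≡′ ; cross-≡ = cross-≡′ }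
  where
  sumA-≡′ : sumA (M′ ++ ys) ≡ sumA (M ++ ys)
  sumA-≡′ rewrite sumA-++ M′ ys | sumA-++ M ys | sumA-≡ δ = refl
  sumB-≡′ : sumB (M′ ++ ys) ≡ sumB (M ++ ys)
  sumB-≡′ rewrite sumB-++ M′ ys | sumB-++ M ys | sumB-≡ δ = refl
  ring : ∀ c d c′ X → (c - d) + c′ + X ≡ c + c′ + X - d
  ring = solve-∀
  cross-≡′ : cross (M′ ++ ys) ≡ cross (M ++ ys) - d
  cross-≡′ rewrite cross-++ M′ ys | cross-++ M ys | cross-≡ δ | sumA-≡ δ | sumB-≡ δ =
    ring (cross M) d (cross ys) (sumA M * sumB ys - sumA ys * sumB M)

CrossDrop-++ˡ : ∀ {d M M′} xs → CrossDrop d M M′ → CrossDrop d (xs ++ M) (xs ++ M′)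
CrossDrop-++ˡ {d} {M} {M′} xs δ = record { sumA-≡ = sumA-≡′ ; sumB-≡ = sumB-≡′ ; cross-≡ = cross-≡′ }
  where
  sumA-≡′ : sumA (xs ++ M′) ≡ sumA (xs ++ M)
  sumA-≡′ rewrite sumA-++ xs M′ | sumA-++ xs M | sumA-≡ δ = refl
  sumB-≡′ : sumB (xs ++ M′) ≡ sumB (xs ++ M)
  sumB-≡′ rewrite sumB-++ xs M′ | sumB-++ xs M | sumB-≡ δ = refl
  ring : ∀ c′ c d X → c′ + (c - d) + X ≡ c′ + c + X - d
  ring = solve-∀
  cross-≡′ : cross (xs ++ M′) ≡ cross (xs ++ M) - d
  cross-≡′ rewrite cross-++ xs M′ | cross-++ xs M | cross-≡ δ | sumA-≡ δ | sumB-≡ δ =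
    ring (cross xs) (cross M) d (sumA xs * sumB M - sumA M * sumB xs)

swap-CrossDrop : ∀ o o′ → CrossDrop (+ 2 * det o o′) (o ∷ o′ ∷ []) (o′ ∷ o ∷ [])
swap-CrossDrop (a , b) (a′ , b′) = record
  { sumA-≡  = +-swap a a′
  ; sumB-≡  = +-swap (+ b) (+ b′)
  ; cross-≡ = antisymmetry a (+ b) a′ (+ b′)
  }
  where
  +-swap : ∀ x y → y + (x + 0ℤ) ≡ x + (y + 0ℤ)
  +-swap = solve-∀
  antisymmetry : ∀ a b a′ b′ →
    (a′ * b - a * b′ + 0ℤ) + (0ℤ + 0ℤ) ≡ (a * b′ - a′ * b + 0ℤ) + (0ℤ + 0ℤ) - + 2 * (a * b′ - a′ * b)
  antisymmetry = solve-∀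

merge : Op → Op → Op
merge (a , b) (a′ , b′) = a + a′ , b +ℕ b′

merge-CrossDrop : ∀ o o′ → CrossDrop (det o o′) (o ∷ o′ ∷ []) (merge o o′ ∷ [])
merge-CrossDrop (a , b) (a′ , b′) = record
  { sumA-≡  = +-assoc′ a a′
  ; sumB-≡  = trans (cong (λ B → B + 0ℤ) (ℤ.pos-+ b b′)) (+-assoc′ (+ b) (+ b′))
  ; cross-≡ = cancel (a * + b′ - a′ * + b)
  }
  where
  +-assoc′ : ∀ x y → x + y + 0ℤ ≡ x + (y + 0ℤ)
  +-assoc′ = solve-∀
  cancel : ∀ d → 0ℤ ≡ d + 0ℤ + (0ℤ + 0ℤ) - d
  cancel = solve-∀

score-CrossDrop : ∀ {d M M′} ks → CrossDrop d M M′ → score (term ks M′) ≡ score (term ks M) - d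
score-CrossDrop {d} {M} {M′} ks δ rewrite sumB-≡ δ | cross-≡ δ = ring (sumℤ ks) (sumB M) (cross M) d
  where
  ring : ∀ k B c d → k - B + (c - d) ≡ k - B + c - d
  ring = solve-∀

score-∷ʳ : ∀ ks k os → score (term (ks ++ [ k ]) os) ≡ score (term ks os) + k
score-∷ʳ ks k os rewrite sumℤ-∷ʳ ks k = ring (sumℤ ks) k (sumB os) (cross os)
  where
  ring : ∀ s k B c → s + k - B + c ≡ s - B + c + k
  ring = solve-∀

passing-score : ∀ ks pre o o′ post →
  score (term ks (pre ++ o′ ∷ o ∷ post)) ≡ score (term ks (pre ++ o ∷ o′ ∷ post)) - + 2 * det o o′
passing-score ks pre o o′ post =
  score-CrossDrop ks (CrossDrop-++ˡ pre (CrossDrop-++ʳ post (swap-CrossDrop o o′)))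

commutation-score : ∀ ks pre o o′ post →
  score (term (ks ++ [ det o o′ ]) (pre ++ merge o o′ ∷ post)) ≡ score (term ks (pre ++ o ∷ o′ ∷ post))
commutation-score ks pre o o′ post = begin
  score (term (ks ++ [ d ]) C)   ≡⟨ score-∷ʳ ks d C ⟩
  score (term ks C) + d          ≡⟨ cong (λ s → s + d) (score-CrossDrop ks merged) ⟩
  score (term ks T) - d + d      ≡⟨ ring (score (term ks T)) d ⟩
  score (term ks T)              ∎
  where
  d : ℤ
  d = det o o′
  T C : List Op
  T = pre ++ o ∷ o′ ∷ post
  C = pre ++ merge o o′ ∷ post
  merged : CrossDrop d T C
  merged = CrossDrop-++ˡ pre (CrossDrop-++ʳ post (merge-CrossDrop o o′))
  ring : ∀ s d → s - d + d ≡ s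
  ring = solve-∀

det-positive : ∀ {a b a′ b′} → 0ℤ < a → a′ ≤ 0ℤ → Good (a , b) → Good (a′ , b′) →
  0ℤ < det (a , b) (a′ , b′)
det-positive {+0} (+<+ ())
det-positive {+[1+ n ]} {a′ = +[1+ m ]} _ (+≤+ ())
det-positive {+[1+ n ]} {a′ = +0} _ _ _ good′ with good′ (+≤+ z≤n)
... | s≤s _ = +<+ (s≤s z≤n)
det-positive {+[1+ n ]} {a′ = -[1+ m ]} {b′} _ _ good _ with good (+≤+ z≤n)
... | s≤s _ = ℤ.+-mono-≤-< (subst (0ℤ ≤_) (ℤ.pos-* (suc n) b′) (+≤+ z≤n)) (+<+ (s≤s z≤n))

step4-scores : ∀ {T P C} → Step4 T P C → All Good (ops T) →
  (score C ≡ score T) × Σ ℤ (λ t → (0ℤ < t) × (score P ≡ score T - + 2 * t))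
step4-scores (step4 ks pre post a a′ b b′ _ 0<a (a′≤0 ∷ _)) good with ++⁻ pre good
... | _ , good-o ∷ good-o′ ∷ _ =
  commutation-score ks pre o o′ post ,
  det o o′ , det-positive 0<a a′≤0 good-o good-o′ , passing-score ks pre o o′ post
  where
  o o′ : Op
  o  = a , b
  o′ = a′ , b′

step-preserves-Good : ∀ {T T′} → Step T T′ → All Good (ops T) → All Good (ops T′)
step-preserves-Good (passing (step4 _ pre _ _ _ _ _ _ _ _)) good with ++⁻ pre good
... | good-pre , good-o ∷ good-o′ ∷ good-post = ++⁺ good-pre (good-o′ ∷ good-o ∷ good-post)
step-preserves-Good (commutation (step4 _ pre _ _ _ b b′ _ 0<a _)) good with ++⁻ pre good
... | good-pre , good-o ∷ _ ∷ good-post =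
  ++⁺ good-pre ((λ _ → ℕ.<-≤-trans (good-o (ℤ.<⇒≤ 0<a)) (ℕ.m≤m+n b b′)) ∷ good-post)

produced-Good : ∀ {T T′} → Produced T T′ → All Good (ops T) → All Good (ops T′)
produced-Good ε         good = good
produced-Good (s ◅ ss) good = produced-Good ss (step-preserves-Good s good)

infix 4 _≤₂_
_≤₂_ : ℤ → ℤ → Set
i ≤₂ j = (i ≤ j) × (+ 2 ∣ j - i)

≤₂-reflexive : ∀ {i j} → i ≡ j → i ≤₂ j
≤₂-reflexive {i} refl rewrite ℤ.+-inverseʳ i = ℤ.≤-refl , 2 ℕD.∣0

≤₂-trans : ∀ {i j k} → i ≤₂ j → j ≤₂ k → i ≤₂ k
≤₂-trans {i} {j} {k} (i≤j , 2∣j-i) (j≤k , 2∣k-j) =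
  ℤ.≤-trans i≤j j≤k ,
  Signed.∣⇒∣ᵤ (subst (Signed._∣_ (+ 2)) (telescope i j k)
    (Signed.∣m∣n⇒∣m+n (Signed.∣ᵤ⇒∣ {i = k - j} 2∣k-j) (Signed.∣ᵤ⇒∣ {i = j - i} 2∣j-i)))
  where
  telescope : ∀ i j k → (k - j) + (j - i) ≡ k - i
  telescope = solve-∀

i≡j-2t⇒i≤₂j : ∀ {i j t} → 0ℤ ≤ t → i ≡ j - + 2 * t → i ≤₂ j
i≡j-2t⇒i≤₂j {j = j} {t} 0≤t refl =
  ℤ.i-j≤i j (+ 2 * t) {{nonNegative (ℤ.*-monoˡ-≤-nonNeg (+ 2) 0≤t)}} ,
  subst (+ 2 ∣_) (sym (cancel j t)) (Signed.∣⇒∣ᵤ (Signed.∣m⇒∣m*n {m = + 2} t Signed.∣-refl))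
  where
  cancel : ∀ j t → j - (j - + 2 * t) ≡ + 2 * t
  cancel = solve-∀

step-score : ∀ {T T′} → Step T T′ → All Good (ops T) → score T′ ≤₂ score T
step-score (passing s) good with step4-scores s good
... | _ , _ , 0<t , passing-eq = i≡j-2t⇒i≤₂j (ℤ.<⇒≤ 0<t) passing-eq
step-score (commutation s) good = ≤₂-reflexive (proj₁ (step4-scores s good))

produced-score : ∀ {T T′} → Produced T T′ → All Good (ops T) → score T′ ≤₂ score T
produced-score ε         _    = ≤₂-reflexive refl
produced-score (s ◅ ss) good = ≤₂-trans (produced-score ss (step-preserves-Good s good)) (step-score s good)

lemma3p8 : (os : List Op) → sumA os ≡ 0ℤ → All Good os →
    ((T P C : Term) → Produced (term [] os) T → Step4 T P C →
       (score C ≡ score T) ×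
       Σ ℤ (λ t → (0ℤ < t) × (score P ≡ score T - + 2 * t)))
    ×
    ((T : Term) → Produced (term [] os) T →
       (score T ≤ score (term [] os)) × (+ 2 ∣ (score (term [] os) - score T)))
lemma3p8 os _ good =
  (λ T P C produced s → step4-scores s (produced-Good produced good)) ,
  (λ T produced → produced-score produced good)
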